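{- For every integer $n\geq 0$, the total of $\mathrm{sumelements}(\pi)$ over all set partitions $\pi$ of $[n]$ is $$\sum_{\pi\in P_n}\mathrm{sumelements}(\pi)=\frac{1}{3}B_{n+3}-\frac{1}{4}B_{n+2}-\left(\frac{1}{2}n+\frac{13}{12}\right)B_{n+1}-\left(\frac{1}{12}+\frac{1}{2}n\right)B_n,$$ where $B_m$ denotes the $m$-th Bell number.
   Context: A set partition of $[n]$ with exactly $k$ blocks is a collection $\{B_1,\dots,B_k\}$ of nonempty pairwise disjoint subsets with union $[n]$, indexed so that $\min B_1<\cdots<\min B_k$; $P_n$ is the set of all set partitions of $[n]$ (with any number of blocks). A partition is identified with its canonical sequential form $\pi=\pi_1\cdots\pi_n$, where $i\in B_{\pi_i}$. An entry $\pi_i$ is a record if $\pi_i>\pi_j$ for all $j<i$; the records are the first occurrences of $1,\dots,k$. For $a\in[k]$, $\mathrm{sumelements}_a(\pi)$ is the sum of all entries of $\pi$ at positions strictly before the record $a$, and $\mathrm{sumelements}(\pi)=\sum_{a=1}^{k}\mathrm{sumelements}_a(\pi)$. For example, $\mathrm{sumelements}(121132)=1+(1+2+1+1)=6$. -}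

module Defs where

open import Data.Nat using (ℕ; zero; suc; _+_; _*_; _≤?_; _<?_)
open import Data.Nat.Combinatorics using (_C_)
open import Data.List using (List; []; _∷_; map; concatMap; filter; upTo)
open import Data.Bool using (Bool; true; false; _∧_; if_then_else_)
open import Relation.Nullary.Decidable using (⌊_⌋)
open import Data.Product using (_×_; _,_)

-- Bell numbers via the standard recurrence B₀ = 1, B_{m+1} = Σ_{k=0}^{m} C(m,k) B_k.
-- Implemented by carrying the list [B_m, ..., B_0] (course-of-values).
bellsRev : ℕ → List ℕ
bellsRev zero = 1 ∷ []
bellsRev (suc m) = next ∷ prev
  where
  prev = bellsRev m
  go : ℕ → List ℕ → ℕ
  go _ [] = 0
  go i (b ∷ bs) = (m C i) * b + go (suc i) bs  -- b = B_{m-i}, C(m,i)=C(m,m-i)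
  next = go 0 prev

head0 : List ℕ → ℕ
head0 [] = 0
head0 (x ∷ _) = x

Bell : ℕ → ℕ
Bell m = head0 (bellsRev m)

words : ℕ → ℕ → List (List ℕ)
words a zero = [] ∷ []
words a (suc l) = concatMap (λ w → map (λ x → suc x ∷ w) (upTo a)) (words a l)

rgsFrom : ℕ → List ℕ → Bool
rgsFrom m [] = true
rgsFrom m (x ∷ xs) = ⌊ 1 ≤? x ⌋ ∧ ⌊ x ≤? suc m ⌋ ∧ rgsFrom (Data.Nat._⊔_ m x) xs

isCanonical : List ℕ → Bool
isCanonical = rgsFrom 0

-- P n : all set partitions of [n], in canonical sequential form.
P : ℕ → List (List ℕ)
P n = filter (λ w → Data.Bool._≟_ (isCanonical w) true) (words n n)

sumelFrom : ℕ → ℕ → List ℕ → ℕ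
sumelFrom m s [] = 0
sumelFrom m s (x ∷ xs) =
  (if ⌊ m <? x ⌋ then s else 0) + sumelFrom (Data.Nat._⊔_ m x) (s + x) xs

sumelements : List ℕ → ℕ
sumelements = sumelFrom 0 0

-- After a canonical prefix whose maximum is m, the next letter either reuses one of the m blocks or
-- opens block m + 1. Over the canonical continuations of length l this gives recurrences in (l, m)
-- for their number T(l, m), their total number of records R(l, m) and their total sumelements
-- U(l, m), since a prefix sum s adds s once per record. Pascal's rule gives
-- T(l, m + 1) = Σₖ C(l, k) T(k, m), the Bell recurrence at m = 0, so T(n, 0) = Bₙ; moreover
-- R(l, m) = T(l, m + 1) - T(l, m), and U(l, m) is a combination of T(l, m), …, T(l, m + 3) with
-- coefficients polynomial in l and m, verified by induction on l as a polynomial identity.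
-- At m = 0, T(n, 1), T(n, 2) and T(n, 3) are B_{n+1}, B_{n+2} - B_{n+1} and B_{n+3} - 3 B_{n+2} + 2 B_{n+1}.
module Submission where

open import Defs
open import Data.List using (List; []; _∷_; map)
open import Data.Nat.ListAction using (sum)
open import Relation.Binary.PropositionalEquality
  using (_≡_; refl; sym; trans; cong; cong₂; module ≡-Reasoning)
open ≡-Reasoning

module FiniteSums where

  open import Data.Bool using (Bool; true; false; if_then_else_)
  import Data.Bool as Bool
  open import Data.List using ([_]; concatMap; filter; upTo; _++_; _∷ʳ_)
  open import Data.List.Properties using (map-++; upTo-∷ʳ)
  open import Data.Nat using (ℕ; zero; suc; _+_; _*_; _∸_; _≤_; _<_)
  open import Data.Nat.Properties
  open import Data.Nat.ListAction.Properties using (sum-++)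
  open import Algebra.Properties.CommutativeSemigroup +-commutativeSemigroup using (interchange)
  open import Function using (_∘_)

  ∑< : ℕ → (ℕ → ℕ) → ℕ
  ∑< zero    f = 0
  ∑< (suc n) f = ∑< n f + f n

  syntax ∑< n (λ x → e) = ∑[ x < n ] e

  ∑-cong : ∀ n {f g : ℕ → ℕ} → (∀ {x} → x < n → f x ≡ g x) → ∑< n f ≡ ∑< n g
  ∑-cong zero    f≡g = refl
  ∑-cong (suc n) f≡g = cong₂ _+_ (∑-cong n (f≡g ∘ m<n⇒m<1+n)) (f≡g ≤-refl)

  ∑-+ : ∀ n (f g : ℕ → ℕ) → ∑[ x < n ] (f x + g x) ≡ ∑< n f + ∑< n g
  ∑-+ zero    f g = refl
  ∑-+ (suc n) f g = trans (cong (_+ (f n + g n)) (∑-+ n f g)) (interchange (∑< n f) (∑< n g) (f n) (g n))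

  ∑-*ˡ : ∀ n c (f : ℕ → ℕ) → ∑[ x < n ] (c * f x) ≡ c * ∑< n f
  ∑-*ˡ zero    c f = sym (*-zeroʳ c)
  ∑-*ˡ (suc n) c f = trans (cong (_+ c * f n) (∑-*ˡ n c f)) (sym (*-distribˡ-+ c (∑< n f) (f n)))

  ∑-*ʳ : ∀ n (f : ℕ → ℕ) c → ∑[ x < n ] (f x * c) ≡ ∑< n f * c
  ∑-*ʳ zero    f c = refl
  ∑-*ʳ (suc n) f c = trans (cong (_+ f n * c) (∑-*ʳ n f c)) (sym (*-distribʳ-+ c (∑< n f) (f n)))

  ∑-const : ∀ n c → ∑[ _ < n ] c ≡ n * c
  ∑-const zero    c = refl
  ∑-const (suc n) c = trans (cong (_+ c) (∑-const n c)) (+-comm (n * c) c)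

  ∑-front : ∀ n (f : ℕ → ℕ) → ∑< (suc n) f ≡ f 0 + ∑[ x < n ] f (suc x)
  ∑-front zero    f = +-comm 0 (f 0)
  ∑-front (suc n) f = trans (cong (_+ f (suc n)) (∑-front n f)) (+-assoc (f 0) _ _)

  ∑-vanishing-tail : ∀ k {n} (f : ℕ → ℕ) → (∀ {x} → n ≤ x → f x ≡ 0) → ∑< (k + n) f ≡ ∑< n f
  ∑-vanishing-tail zero        f f≡0 = refl
  ∑-vanishing-tail (suc k) {n} f f≡0 = begin
    ∑< (k + n) f + f (k + n)  ≡⟨ cong₂ _+_ (∑-vanishing-tail k f f≡0) (f≡0 (m≤n+m n k)) ⟩
    ∑< n f + 0                ≡⟨ +-identityʳ (∑< n f) ⟩
    ∑< n f                    ∎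

  ∑-truncate : ∀ {m a} (f : ℕ → ℕ) → m < a → (∀ {x} → m < x → f x ≡ 0) → ∑< a f ≡ ∑< m f + f m
  ∑-truncate {m} {a} f m<a f≡0 = begin
    ∑< a f                    ≡⟨ cong (λ n → ∑< n f) (m∸n+n≡m m<a) ⟨
    ∑< (a ∸ suc m + suc m) f  ≡⟨ ∑-vanishing-tail (a ∸ suc m) f f≡0 ⟩
    ∑< m f + f m              ∎

  sum-map-upTo : ∀ (f : ℕ → ℕ) n → sum (map f (upTo n)) ≡ ∑< n f
  sum-map-upTo f zero    = refl
  sum-map-upTo f (suc n) = begin
    sum (map f (upTo (suc n)))        ≡⟨ cong (sum ∘ map f) (upTo-∷ʳ n) ⟨
    sum (map f (upTo n ∷ʳ n))         ≡⟨ cong sum (map-++ f (upTo n) [ n ]) ⟩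
    sum (map f (upTo n) ++ [ f n ])   ≡⟨ sum-++ (map f (upTo n)) [ f n ] ⟩
    sum (map f (upTo n)) + (f n + 0)  ≡⟨ cong₂ _+_ (sum-map-upTo f n) (+-identityʳ (f n)) ⟩
    ∑< n f + f n                      ∎

  module _ {A : Set} where

    sum-map-+ : ∀ (f g : A → ℕ) xs → sum (map (λ x → f x + g x) xs) ≡ sum (map f xs) + sum (map g xs)
    sum-map-+ f g []       = refl
    sum-map-+ f g (x ∷ xs) = trans (cong (f x + g x +_) (sum-map-+ f g xs)) (interchange (f x) (g x) _ _)

    sum-map-*ˡ : ∀ c (f : A → ℕ) xs → sum (map (λ x → c * f x) xs) ≡ c * sum (map f xs)
    sum-map-*ˡ c f []       = sym (*-zeroʳ c)
    sum-map-*ˡ c f (x ∷ xs) = trans (cong (c * f x +_) (sum-map-*ˡ c f xs)) (sym (*-distribˡ-+ c (f x) _))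

    sum-map-∑ : ∀ n (h : ℕ → A → ℕ) xs →
      sum (map (λ w → ∑[ x < n ] h x w) xs) ≡ ∑[ x < n ] sum (map (h x) xs)
    sum-map-∑ zero    h xs = sum-map-0 xs
      where
      sum-map-0 : ∀ xs → sum (map (λ _ → 0) xs) ≡ 0
      sum-map-0 []       = refl
      sum-map-0 (_ ∷ xs) = sum-map-0 xs
    sum-map-∑ (suc n) h xs =
      trans (sum-map-+ (λ w → ∑[ x < n ] h x w) (h n) xs) (cong (_+ sum (map (h n) xs)) (sum-map-∑ n h xs))

    sum-map-concatMap : ∀ {B : Set} (f : B → ℕ) (g : A → List B) xs →
      sum (map f (concatMap g xs)) ≡ sum (map (λ x → sum (map f (g x))) xs)
    sum-map-concatMap f g []       = refl
    sum-map-concatMap f g (x ∷ xs) = begin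
      sum (map f (g x ++ concatMap g xs))               ≡⟨ cong sum (map-++ f (g x) (concatMap g xs)) ⟩
      sum (map f (g x) ++ map f (concatMap g xs))       ≡⟨ sum-++ (map f (g x)) _ ⟩
      sum (map f (g x)) + sum (map f (concatMap g xs))  ≡⟨ cong (sum (map f (g x)) +_) (sum-map-concatMap f g xs) ⟩
      sum (map f (g x)) + sum (map (λ x → sum (map f (g x))) xs) ∎

    sum-map-filter : ∀ (b : A → Bool) (f : A → ℕ) xs →
      sum (map f (filter (λ x → b x Bool.≟ true) xs)) ≡ sum (map (λ x → if b x then f x else 0) xs)
    sum-map-filter b f []       = refl
    sum-map-filter b f (x ∷ xs) with b x
    ... | true  = cong (f x +_) (sum-map-filter b f xs)
    ... | false = sum-map-filter b f xs

module Continuations where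

  open FiniteSums
  open import Data.Bool using (true; false; if_then_else_)
  open import Data.List using (upTo)
  open import Data.List.Properties using (map-cong; map-∘)
  open import Data.Nat using (ℕ; zero; suc; _+_; _*_; _⊔_; _≤_; _<_; s≤s; _≤?_; _<?_)
  open import Data.Nat.Properties
  open import Data.Nat.Tactic.RingSolver using (solve-∀)
  open import Algebra.Properties.CommutativeSemigroup +-commutativeSemigroup using (interchange)
  open import Relation.Nullary.Decidable using (Dec; ⌊_⌋; isYes≗does; dec-true; dec-false)
  open import Relation.Nullary.Negation using (¬_)

  private
    ⌊⌋-true : ∀ {A : Set} (d : Dec A) → A → ⌊ d ⌋ ≡ true
    ⌊⌋-true d a = trans (isYes≗does d) (dec-true d a)

    ⌊⌋-false : ∀ {A : Set} (d : Dec A) → ¬ A → ⌊ d ⌋ ≡ false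
    ⌊⌋-false d ¬a = trans (isYes≗does d) (dec-false d ¬a)

  recordsFrom : ℕ → List ℕ → ℕ
  recordsFrom m []       = 0
  recordsFrom m (x ∷ xs) = (if ⌊ m <? x ⌋ then 1 else 0) + recordsFrom (m ⊔ x) xs

  module _ {m x : ℕ} (w : List ℕ) (x<m : x < m) where

    rgsFrom-below : rgsFrom m (suc x ∷ w) ≡ rgsFrom m w
    rgsFrom-below rewrite ⌊⌋-true (suc x ≤? suc m) (s≤s (<⇒≤ x<m)) | m≥n⇒m⊔n≡m x<m = refl

    recordsFrom-below : recordsFrom m (suc x ∷ w) ≡ recordsFrom m w
    recordsFrom-below rewrite ⌊⌋-false (m <? suc x) (≤⇒≯ x<m) | m≥n⇒m⊔n≡m x<m = refl

    sumelFrom-below : ∀ s → sumelFrom m s (suc x ∷ w) ≡ sumelFrom m (s + suc x) w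
    sumelFrom-below s rewrite ⌊⌋-false (m <? suc x) (≤⇒≯ x<m) | m≥n⇒m⊔n≡m x<m = refl

  module _ (m : ℕ) (w : List ℕ) where

    private
      m⊔1+m≡1+m : m ⊔ suc m ≡ suc m
      m⊔1+m≡1+m = m≤n⇒m⊔n≡n (n≤1+n m)

    rgsFrom-record : rgsFrom m (suc m ∷ w) ≡ rgsFrom (suc m) w
    rgsFrom-record rewrite ⌊⌋-true (suc m ≤? suc m) ≤-refl | m⊔1+m≡1+m = refl

    recordsFrom-record : recordsFrom m (suc m ∷ w) ≡ 1 + recordsFrom (suc m) w
    recordsFrom-record rewrite ⌊⌋-true (m <? suc m) ≤-refl | m⊔1+m≡1+m = refl

    sumelFrom-record : ∀ s → sumelFrom m s (suc m ∷ w) ≡ s + sumelFrom (suc m) (s + suc m) w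
    sumelFrom-record s rewrite ⌊⌋-true (m <? suc m) ≤-refl | m⊔1+m≡1+m = refl

  rgsFrom-above : ∀ {m x} (w : List ℕ) → m < x → rgsFrom m (suc x ∷ w) ≡ false
  rgsFrom-above {m} {x} w m<x rewrite ⌊⌋-false (suc x ≤? suc m) (<⇒≱ (s≤s m<x)) = refl

  sumelFrom-shift : ∀ m s t (w : List ℕ) → sumelFrom m (s + t) w ≡ s * recordsFrom m w + sumelFrom m t w
  sumelFrom-shift m s t []      = sym (trans (+-identityʳ (s * 0)) (*-zeroʳ s))
  sumelFrom-shift m s t (x ∷ w) = by-record? ⌊ m <? x ⌋
    where
    r = recordsFrom (m ⊔ x) w
    sumel = sumelFrom (m ⊔ x) (t + x) w
    shifted : sumelFrom (m ⊔ x) (s + t + x) w ≡ s * r + sumel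
    shifted = trans (cong (λ u → sumelFrom (m ⊔ x) u w) (+-assoc s t x)) (sumelFrom-shift (m ⊔ x) s (t + x) w)
    by-record? : ∀ b → (if b then s + t else 0) + sumelFrom (m ⊔ x) (s + t + x) w
                         ≡ s * ((if b then 1 else 0) + r) + ((if b then t else 0) + sumel)
    by-record? false = shifted
    by-record? true  = begin
      s + t + sumelFrom (m ⊔ x) (s + t + x) w  ≡⟨ cong (s + t +_) shifted ⟩
      s + t + (s * r + sumel)                  ≡⟨ interchange s t (s * r) sumel ⟩
      s + s * r + (t + sumel)                  ≡⟨ cong (_+ (t + sumel)) (*-suc s r) ⟨
      s * suc r + (t + sumel)                  ∎

  sumelFrom-shift₀ : ∀ m s (w : List ℕ) → sumelFrom m s w ≡ s * recordsFrom m w + sumelFrom m 0 w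
  sumelFrom-shift₀ m s w = trans (cong (λ u → sumelFrom m u w) (sym (+-identityʳ s))) (sumelFrom-shift m s 0 w)

  sumRgsFrom : (a l m : ℕ) → (List ℕ → ℕ) → ℕ
  sumRgsFrom a l m f = sum (map (λ w → if rgsFrom m w then f w else 0) (words a l))

  module _ (a l m : ℕ) where

    sumRgsFrom-cong : ∀ {f g : List ℕ → ℕ} → (∀ w → f w ≡ g w) → sumRgsFrom a l m f ≡ sumRgsFrom a l m g
    sumRgsFrom-cong f≡g = cong sum (map-cong (λ w → cong (λ v → if rgsFrom m w then v else 0) (f≡g w)) (words a l))

    sumRgsFrom-+ : ∀ (f g : List ℕ → ℕ) →
      sumRgsFrom a l m (λ w → f w + g w) ≡ sumRgsFrom a l m f + sumRgsFrom a l m g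
    sumRgsFrom-+ f g = trans (cong sum (map-cong (λ w → if-+ (rgsFrom m w)) (words a l))) (sum-map-+ _ _ (words a l))
      where
      if-+ : ∀ b {x y} → (if b then x + y else 0) ≡ (if b then x else 0) + (if b then y else 0)
      if-+ true  = refl
      if-+ false = refl

    sumRgsFrom-*ˡ : ∀ c (f : List ℕ → ℕ) → sumRgsFrom a l m (λ w → c * f w) ≡ c * sumRgsFrom a l m f
    sumRgsFrom-*ˡ c f = trans (cong sum (map-cong (λ w → if-* (rgsFrom m w)) (words a l))) (sum-map-*ˡ c _ (words a l))
      where
      if-* : ∀ b {x} → (if b then c * x else 0) ≡ c * (if b then x else 0)
      if-* true  = refl
      if-* false = sym (*-zeroʳ c)

  sum-words-suc : ∀ (g : List ℕ → ℕ) a l →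
    sum (map g (words a (suc l))) ≡ sum (map (λ w → ∑[ x < a ] g (suc x ∷ w)) (words a l))
  sum-words-suc g a l = trans (sum-map-concatMap g _ (words a l)) (cong sum (map-cong sum-upTo (words a l)))
    where
    sum-upTo : ∀ w → sum (map g (map (λ x → suc x ∷ w) (upTo a))) ≡ ∑[ x < a ] g (suc x ∷ w)
    sum-upTo w = trans (cong sum (sym (map-∘ (upTo a)))) (sum-map-upTo _ a)

  ∑-first-letter : ∀ {m a} (f : List ℕ → ℕ) w → m < a →
    ∑[ x < a ] (if rgsFrom m (suc x ∷ w) then f (suc x ∷ w) else 0)
    ≡ ∑[ x < m ] (if rgsFrom m w then f (suc x ∷ w) else 0) + (if rgsFrom (suc m) w then f (suc m ∷ w) else 0)
  ∑-first-letter {m} f w m<a = trans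
    (∑-truncate _ m<a (λ {x} m<x → cong (λ b → if b then f (suc x ∷ w) else 0) (rgsFrom-above w m<x)))
    (cong₂ _+_ (∑-cong m (λ {x} x<m → cong (λ b → if b then f (suc x ∷ w) else 0) (rgsFrom-below w x<m)))
               (cong (λ b → if b then f (suc m ∷ w) else 0) (rgsFrom-record m w)))

  sumRgsFrom-suc : ∀ {a m} l (f : List ℕ → ℕ) → m < a →
    sumRgsFrom a (suc l) m f
    ≡ ∑[ x < m ] sumRgsFrom a l m (λ w → f (suc x ∷ w)) + sumRgsFrom a l (suc m) (λ w → f (suc m ∷ w))
  sumRgsFrom-suc {a} {m} l f m<a = begin
    sumRgsFrom a (suc l) m f
      ≡⟨ sum-words-suc _ a l ⟩
    sum (map (λ w → ∑[ x < a ] (if rgsFrom m (suc x ∷ w) then f (suc x ∷ w) else 0)) (words a l))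
      ≡⟨ cong sum (map-cong (λ w → ∑-first-letter f w m<a) (words a l)) ⟩
    sum (map (λ w → ∑[ x < m ] (if rgsFrom m w then f (suc x ∷ w) else 0)
                    + (if rgsFrom (suc m) w then f (suc m ∷ w) else 0)) (words a l))
      ≡⟨ sum-map-+ _ _ (words a l) ⟩
    sum (map (λ w → ∑[ x < m ] (if rgsFrom m w then f (suc x ∷ w) else 0)) (words a l))
      + sumRgsFrom a l (suc m) (λ w → f (suc m ∷ w))
      ≡⟨ cong (_+ sumRgsFrom a l (suc m) (λ w → f (suc m ∷ w))) (sum-map-∑ m _ (words a l)) ⟩
    ∑[ x < m ] sumRgsFrom a l m (λ w → f (suc x ∷ w)) + sumRgsFrom a l (suc m) (λ w → f (suc m ∷ w)) ∎

  -- Number, total records and total sumelements (from prefix sum 0) of the canonical continuations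
  -- of length l of a prefix with maximum m.
  nRGS : ℕ → ℕ → ℕ
  nRGS zero    m = 1
  nRGS (suc l) m = m * nRGS l m + nRGS l (suc m)

  totalRecords : ℕ → ℕ → ℕ
  totalRecords zero    m = 0
  totalRecords (suc l) m = m * totalRecords l m + (nRGS l (suc m) + totalRecords l (suc m))

  triangle : ℕ → ℕ
  triangle m = ∑[ x < m ] suc x

  totalSumel : ℕ → ℕ → ℕ
  totalSumel zero    m = 0
  totalSumel (suc l) m =
    (triangle m * totalRecords l m + m * totalSumel l m) + (suc m * totalRecords l (suc m) + totalSumel l (suc m))

  private
    module Room (l m a : ℕ) (room : suc l + m ≤ a) where
      m<a : m < a
      m<a = ≤-trans (s≤s (m≤n+m m l)) room
      l+m≤a : l + m ≤ a
      l+m≤a = <⇒≤ room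
      l+[1+m]≤a : l + suc m ≤ a
      l+[1+m]≤a = ≤-trans (≤-reflexive (+-suc l m)) room

  sumRgsFrom-nRGS : ∀ l m {a} → l + m ≤ a → sumRgsFrom a l m (λ _ → 1) ≡ nRGS l m
  sumRgsFrom-nRGS zero    m     room = refl
  sumRgsFrom-nRGS (suc l) m {a} room = begin
    sumRgsFrom a (suc l) m (λ _ → 1)
      ≡⟨ sumRgsFrom-suc l _ m<a ⟩
    ∑[ _ < m ] sumRgsFrom a l m (λ _ → 1) + sumRgsFrom a l (suc m) (λ _ → 1)
      ≡⟨ cong₂ _+_ (trans (∑-const m _) (cong (m *_) (sumRgsFrom-nRGS l m l+m≤a)))
                   (sumRgsFrom-nRGS l (suc m) l+[1+m]≤a) ⟩
    m * nRGS l m + nRGS l (suc m) ∎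
    where open Room l m a room

  sumRgsFrom-records : ∀ l m {a} → l + m ≤ a → sumRgsFrom a l m (recordsFrom m) ≡ totalRecords l m
  sumRgsFrom-records zero    m     room = refl
  sumRgsFrom-records (suc l) m {a} room = begin
    sumRgsFrom a (suc l) m (recordsFrom m)
      ≡⟨ sumRgsFrom-suc l _ m<a ⟩
    ∑[ x < m ] sumRgsFrom a l m (λ w → recordsFrom m (suc x ∷ w))
      + sumRgsFrom a l (suc m) (λ w → recordsFrom m (suc m ∷ w))
      ≡⟨ cong₂ _+_ (∑-cong m (λ x<m → sumRgsFrom-cong a l m (λ w → recordsFrom-below w x<m)))
                   (sumRgsFrom-cong a l (suc m) (recordsFrom-record m)) ⟩
    ∑[ _ < m ] sumRgsFrom a l m (recordsFrom m) + sumRgsFrom a l (suc m) (λ w → 1 + recordsFrom (suc m) w)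
      ≡⟨ cong₂ _+_ (∑-const m _) (sumRgsFrom-+ a l (suc m) _ _) ⟩
    m * sumRgsFrom a l m (recordsFrom m) + (sumRgsFrom a l (suc m) (λ _ → 1) + sumRgsFrom a l (suc m) (recordsFrom (suc m)))
      ≡⟨ cong₂ (λ r n′r′ → m * r + n′r′) (sumRgsFrom-records l m l+m≤a)
               (cong₂ _+_ (sumRgsFrom-nRGS l (suc m) l+[1+m]≤a) (sumRgsFrom-records l (suc m) l+[1+m]≤a)) ⟩
    m * totalRecords l m + (nRGS l (suc m) + totalRecords l (suc m)) ∎
    where open Room l m a room

  sumRgsFrom-sumel : ∀ l m {a} → l + m ≤ a → sumRgsFrom a l m (sumelFrom m 0) ≡ totalSumel l m
  sumRgsFrom-sumel zero    m     room = refl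
  sumRgsFrom-sumel (suc l) m {a} room = begin
    sumRgsFrom a (suc l) m (sumelFrom m 0)
      ≡⟨ sumRgsFrom-suc l _ m<a ⟩
    ∑[ x < m ] sumRgsFrom a l m (λ w → sumelFrom m 0 (suc x ∷ w))
      + sumRgsFrom a l (suc m) (λ w → sumelFrom m 0 (suc m ∷ w))
      ≡⟨ cong₂ _+_
           (∑-cong m (λ x<m → sumRgsFrom-cong a l m (λ w →
              trans (sumelFrom-below w x<m 0) (sumelFrom-shift₀ m _ w))))
           (sumRgsFrom-cong a l (suc m) (λ w →
              trans (sumelFrom-record m w 0) (sumelFrom-shift₀ (suc m) (suc m) w))) ⟩
    ∑[ x < m ] sumRgsFrom a l m (λ w → suc x * recordsFrom m w + sumelFrom m 0 w)
      + sumRgsFrom a l (suc m) (λ w → suc m * recordsFrom (suc m) w + sumelFrom (suc m) 0 w)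
      ≡⟨ cong₂ _+_ (∑-cong m (λ {x} _ → split l m (suc x) l+m≤a)) (split l (suc m) (suc m) l+[1+m]≤a) ⟩
    ∑[ x < m ] (suc x * totalRecords l m + totalSumel l m) + (suc m * totalRecords l (suc m) + totalSumel l (suc m))
      ≡⟨ cong (_+ (suc m * totalRecords l (suc m) + totalSumel l (suc m)))
              (trans (∑-+ m _ _) (cong₂ _+_ (∑-*ʳ m suc _) (∑-const m _))) ⟩
    (triangle m * totalRecords l m + m * totalSumel l m) + (suc m * totalRecords l (suc m) + totalSumel l (suc m)) ∎
    where
    open Room l m a room
    split : ∀ l m c {a} → l + m ≤ a →
      sumRgsFrom a l m (λ w → c * recordsFrom m w + sumelFrom m 0 w) ≡ c * totalRecords l m + totalSumel l m
    split l m c {a} room = begin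
      sumRgsFrom a l m (λ w → c * recordsFrom m w + sumelFrom m 0 w)
        ≡⟨ sumRgsFrom-+ a l m _ _ ⟩
      sumRgsFrom a l m (λ w → c * recordsFrom m w) + sumRgsFrom a l m (sumelFrom m 0)
        ≡⟨ cong₂ _+_ (trans (sumRgsFrom-*ˡ a l m c _) (cong (c *_) (sumRgsFrom-records l m room)))
                     (sumRgsFrom-sumel l m room) ⟩
      c * totalRecords l m + totalSumel l m ∎

  sum-sumelements : ∀ n → sum (map sumelements (P n)) ≡ totalSumel n 0
  sum-sumelements n = trans (sum-map-filter isCanonical sumelements (words n n))
                            (sumRgsFrom-sumel n 0 (≤-reflexive (+-identityʳ n)))

  totalRecords-closed : ∀ l m → totalRecords l m + nRGS l m ≡ nRGS l (suc m)
  totalRecords-closed zero    m = refl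
  totalRecords-closed (suc l) m = begin
    (m * R + (T′ + R′)) + (m * T + T′)  ≡⟨ regroup m R T T′ R′ ⟩
    m * (R + T) + (T′ + (R′ + T′))
      ≡⟨ cong₂ (λ x y → m * x + (T′ + y)) (totalRecords-closed l m) (totalRecords-closed l (suc m)) ⟩
    m * T′ + (T′ + nRGS l (suc (suc m))) ≡⟨ +-assoc (m * T′) T′ _ ⟨
    m * T′ + T′ + nRGS l (suc (suc m))   ≡⟨ cong (_+ nRGS l (suc (suc m))) (+-comm (m * T′) T′) ⟩
    suc m * T′ + nRGS l (suc (suc m))    ∎
    where
    R = totalRecords l m
    R′ = totalRecords l (suc m)
    T = nRGS l m
    T′ = nRGS l (suc m)
    regroup : ∀ m r t t′ r′ → (m * r + (t′ + r′)) + (m * t + t′) ≡ m * (r + t) + (t′ + (r′ + t′))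
    regroup = solve-∀

module BellNumbers where

  open FiniteSums
  open Continuations using (nRGS)
  open import Data.Nat using (ℕ; zero; suc; _+_; _*_; _∸_)
  open import Data.Nat.Properties
  open import Data.Nat.Combinatorics using (_C_; nCk≡nC[n∸k]; k>n⇒nCk≡0; nCk+nC[k+1]≡[n+1]C[k+1])
  open import Data.Nat.Induction using (<-rec)
  open import Data.Nat.Tactic.RingSolver using (solve-∀)
  open import Algebra.Properties.CommutativeSemigroup *-commutativeSemigroup using (x∙yz≈y∙xz)

  binomSum : ℕ → ℕ → List ℕ → ℕ
  binomSum m i []       = 0
  binomSum m i (b ∷ bs) = (m C i) * b + binomSum m (suc i) bs

  binomSum-unique : ∀ m (g : ℕ → List ℕ → ℕ) → (∀ i → g i [] ≡ 0) →
    (∀ i b bs → g i (b ∷ bs) ≡ (m C i) * b + g (suc i) bs) → ∀ i bs → g i bs ≡ binomSum m i bs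
  binomSum-unique m g g-[] g-∷ i []       = g-[] i
  binomSum-unique m g g-[] g-∷ i (b ∷ bs) =
    trans (g-∷ i b bs) (cong ((m C i) * b +_) (binomSum-unique m g g-[] g-∷ (suc i) bs))

  -- The summation in `bellsRev` is a local function; abstracting its arguments lets
  -- unification solve for it in `binomSum-unique`.
  Bell-suc-binomSum : ∀ m → Bell (suc m) ≡ binomSum m 0 (bellsRev m)
  Bell-suc-binomSum m with binomSum-unique m _ (λ _ → refl) (λ _ _ _ → refl)
  ... | go≡binomSum with 0 | bellsRev m
  ...   | i | bs = go≡binomSum i bs

  binomSum-bellsRev : ∀ m i j → binomSum m i (bellsRev j) ≡ ∑[ k < suc j ] ((m C (i + j ∸ k)) * Bell k)
  binomSum-bellsRev m i zero    = trans (+-identityʳ ((m C i) * 1)) (cong (λ n → (m C n) * 1) (sym (+-identityʳ i)))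
  binomSum-bellsRev m i (suc j) = begin
    (m C i) * Bell (suc j) + binomSum m (suc i) (bellsRev j)
      ≡⟨ cong₂ _+_ (cong (λ n → (m C n) * Bell (suc j)) (sym (m+n∸n≡m i (suc j))))
                   (binomSum-bellsRev m (suc i) j) ⟩
    (m C (i + suc j ∸ suc j)) * Bell (suc j) + ∑[ k < suc j ] ((m C (suc i + j ∸ k)) * Bell k)
      ≡⟨ +-comm ((m C (i + suc j ∸ suc j)) * Bell (suc j)) _ ⟩
    ∑[ k < suc j ] ((m C (suc i + j ∸ k)) * Bell k) + (m C (i + suc j ∸ suc j)) * Bell (suc j)
      ≡⟨ cong (λ n → ∑[ k < suc j ] ((m C (n ∸ k)) * Bell k) + (m C (i + suc j ∸ suc j)) * Bell (suc j))
              (sym (+-suc i j)) ⟩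
    ∑[ k < suc (suc j) ] ((m C (i + suc j ∸ k)) * Bell k) ∎

  Bell-suc : ∀ m → Bell (suc m) ≡ ∑[ k < suc m ] ((m C k) * Bell k)
  Bell-suc m = begin
    Bell (suc m)                              ≡⟨ Bell-suc-binomSum m ⟩
    binomSum m 0 (bellsRev m)                 ≡⟨ binomSum-bellsRev m 0 m ⟩
    ∑[ k < suc m ] ((m C (m ∸ k)) * Bell k)
      ≡⟨ ∑-cong (suc m) (λ {k} k<1+m → cong (_* Bell k) (sym (nCk≡nC[n∸k] (≤-pred k<1+m)))) ⟩
    ∑[ k < suc m ] ((m C k) * Bell k)         ∎

  ∑-pascal : ∀ l (f : ℕ → ℕ) →
    ∑[ k < suc (suc l) ] ((suc l C k) * f k) ≡ ∑[ k < suc l ] ((l C k) * f k) + ∑[ k < suc l ] ((l C k) * f (suc k))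
  ∑-pascal l f = begin
    ∑[ k < suc (suc l) ] ((suc l C k) * f k)
      ≡⟨ ∑-front (suc l) _ ⟩
    1 * f 0 + ∑[ k < suc l ] ((suc l C suc k) * f (suc k))
      ≡⟨ cong (1 * f 0 +_) (∑-cong (suc l) (λ {k} _ → pascal k)) ⟩
    1 * f 0 + ∑[ k < suc l ] ((l C k) * f (suc k) + (l C suc k) * f (suc k))
      ≡⟨ cong (1 * f 0 +_) (∑-+ (suc l) _ _) ⟩
    1 * f 0 + (A + (B + (l C suc l) * f (suc l)))
      ≡⟨ cong (λ c → 1 * f 0 + (A + (B + c * f (suc l)))) (k>n⇒nCk≡0 (n<1+n l)) ⟩
    1 * f 0 + (A + (B + 0))
      ≡⟨ rearrange (1 * f 0) A B ⟩
    (1 * f 0 + B) + A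
      ≡⟨ cong (_+ A) (∑-front l _) ⟨
    ∑[ k < suc l ] ((l C k) * f k) + A ∎
    where
    A = ∑[ k < suc l ] ((l C k) * f (suc k))
    B = ∑[ k < l ] ((l C suc k) * f (suc k))
    pascal : ∀ k → (suc l C suc k) * f (suc k) ≡ (l C k) * f (suc k) + (l C suc k) * f (suc k)
    pascal k = trans (cong (_* f (suc k)) (sym (nCk+nC[k+1]≡[n+1]C[k+1] l k))) (*-distribʳ-+ (f (suc k)) (l C k) (l C suc k))
    rearrange : ∀ x a b → x + (a + (b + 0)) ≡ (x + b) + a
    rearrange = solve-∀

  nRGS-binomial : ∀ l m → nRGS l (suc m) ≡ ∑[ k < suc l ] ((l C k) * nRGS k m)
  nRGS-binomial zero    m = refl
  nRGS-binomial (suc l) m = sym (begin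
    ∑[ k < suc (suc l) ] ((suc l C k) * nRGS k m)
      ≡⟨ ∑-pascal l (λ k → nRGS k m) ⟩
    ∑[ k < suc l ] ((l C k) * nRGS k m) + ∑[ k < suc l ] ((l C k) * (m * nRGS k m + nRGS k (suc m)))
      ≡⟨ cong (∑[ k < suc l ] ((l C k) * nRGS k m) +_)
              (trans (∑-cong (suc l) (λ {k} _ → distrib k)) (∑-+ (suc l) _ _)) ⟩
    ∑[ k < suc l ] ((l C k) * nRGS k m)
      + (∑[ k < suc l ] (m * ((l C k) * nRGS k m)) + ∑[ k < suc l ] ((l C k) * nRGS k (suc m)))
      ≡⟨ cong₂ (λ x y → x + (y + ∑[ k < suc l ] ((l C k) * nRGS k (suc m))))
               (sym (nRGS-binomial l m)) (trans (∑-*ˡ (suc l) m _) (cong (m *_) (sym (nRGS-binomial l m)))) ⟩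
    nRGS l (suc m) + (m * nRGS l (suc m) + ∑[ k < suc l ] ((l C k) * nRGS k (suc m)))
      ≡⟨ cong (λ y → nRGS l (suc m) + (m * nRGS l (suc m) + y)) (sym (nRGS-binomial l (suc m))) ⟩
    nRGS l (suc m) + (m * nRGS l (suc m) + nRGS l (suc (suc m)))
      ≡⟨ +-assoc (nRGS l (suc m)) _ _ ⟨
    suc m * nRGS l (suc m) + nRGS l (suc (suc m)) ∎)
    where
    distrib : ∀ k → (l C k) * (m * nRGS k m + nRGS k (suc m)) ≡ m * ((l C k) * nRGS k m) + (l C k) * nRGS k (suc m)
    distrib k = trans (*-distribˡ-+ (l C k) _ _) (cong (_+ (l C k) * nRGS k (suc m)) (x∙yz≈y∙xz (l C k) m (nRGS k m)))

  nRGS-Bell : ∀ n → nRGS n 0 ≡ Bell n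
  nRGS-Bell = <-rec _ λ where
    zero    _   → refl
    (suc n) rec → begin
      nRGS n 1                              ≡⟨ nRGS-binomial n 0 ⟩
      ∑[ k < suc n ] ((n C k) * nRGS k 0)   ≡⟨ ∑-cong (suc n) (λ {k} k<1+n → cong ((n C k) *_) (rec k<1+n)) ⟩
      ∑[ k < suc n ] ((n C k) * Bell k)     ≡⟨ Bell-suc n ⟨
      Bell (suc n)                          ∎

  Bell-+ : ∀ n k → Bell (n + k) ≡ nRGS (k + n) 0
  Bell-+ n k = trans (cong Bell (+-comm n k)) (sym (nRGS-Bell (k + n)))

  nRGS-2+n : ∀ n → nRGS (2 + n) 0 ≡ nRGS n 1 + nRGS n 2
  nRGS-2+n n = cong (_+ nRGS n 2) (*-identityˡ (nRGS n 1))

  nRGS-3+n : ∀ n → nRGS (3 + n) 0 ≡ nRGS n 1 + 3 * nRGS n 2 + nRGS n 3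
  nRGS-3+n n = unfolded (nRGS n 1) (nRGS n 2) (nRGS n 3)
    where
    unfolded : ∀ a b c → 1 * (1 * a + b) + (2 * b + c) ≡ a + 3 * b + c
    unfolded = solve-∀

open Continuations using (nRGS; totalRecords; triangle; totalSumel; totalRecords-closed; sum-sumelements)
open BellNumbers using (nRGS-Bell; Bell-+; nRGS-2+n; nRGS-3+n)
open import Data.Nat using (ℕ; zero; suc) renaming (_+_ to _+ℕ_; _*_ to _*ℕ_)
open import Data.Nat.Coprimality using (1-coprimeTo) renaming (sym to coprime-sym)
open import Data.Integer as ℤ using (+_)
import Data.Integer.Properties as ℤ
open import Data.Rational using (ℚ; mkℚ; _/_; _+_; _*_; _-_; 0ℚ; 1ℚ; ½)
open import Data.Rational.Properties using (normalize-coprime; /-cong)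
open import Data.Rational.Solver using (module +-*-Solver)
open +-*-Solver using (solve; Polynomial; con; _:+_; _:*_; _:-_; _:=_)

ι : ℕ → ℚ
ι n = + n / 1

ι-mkℚ : ∀ n → ι n ≡ mkℚ (+ n) 0 (coprime-sym (1-coprimeTo n))
ι-mkℚ n = normalize-coprime (coprime-sym (1-coprimeTo n))

ι-+ : ∀ m n → ι (m +ℕ n) ≡ ι m + ι n
ι-+ m n = begin
  + (m +ℕ n) / 1
    ≡⟨ /-cong (trans (ℤ.pos-+ m n) (sym (cong₂ ℤ._+_ (ℤ.*-identityʳ (+ m)) (ℤ.*-identityʳ (+ n))))) refl ⟩
  (+ m ℤ.* + 1 ℤ.+ + n ℤ.* + 1) / 1  ≡⟨ cong₂ _+_ (ι-mkℚ m) (ι-mkℚ n) ⟨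
  ι m + ι n                          ∎

ι-* : ∀ m n → ι (m *ℕ n) ≡ ι m * ι n
ι-* m n = trans (cong (_/ 1) (ℤ.pos-* m n)) (sym (cong₂ _*_ (ι-mkℚ m) (ι-mkℚ n)))

ι-nRGS-suc : ∀ l m → ι (nRGS (suc l) m) ≡ ι m * ι (nRGS l m) + ι (nRGS l (suc m))
ι-nRGS-suc l m = trans (ι-+ (m *ℕ nRGS l m) _) (cong (_+ ι (nRGS l (suc m))) (ι-* m (nRGS l m)))

ι-totalRecords : ∀ l m → ι (totalRecords l m) ≡ ι (nRGS l (suc m)) - ι (nRGS l m)
ι-totalRecords l m = begin
  ι R                       ≡⟨ solve 2 (λ r t → r := (r :+ t) :- t) refl (ι R) (ι T) ⟩
  (ι R + ι T) - ι T         ≡⟨ cong (_- ι T) (trans (sym (ι-+ R T)) (cong ι (totalRecords-closed l m))) ⟩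
  ι (nRGS l (suc m)) - ι T  ∎
  where
  R = totalRecords l m
  T = nRGS l m

ι-triangle : ∀ m → ι (triangle m) ≡ ½ * ι m * (1ℚ + ι m)
ι-triangle zero    = refl
ι-triangle (suc m) = begin
  ι (triangle m +ℕ suc m)                ≡⟨ ι-+ (triangle m) (suc m) ⟩
  ι (triangle m) + ι (suc m)             ≡⟨ cong₂ _+_ (ι-triangle m) (ι-+ 1 m) ⟩
  ½ * ι m * (1ℚ + ι m) + (1ℚ + ι m)
    ≡⟨ solve 1 (λ M → con ½ :* M :* (con 1ℚ :+ M) :+ (con 1ℚ :+ M)
                      := con ½ :* (con 1ℚ :+ M) :* (con 1ℚ :+ (con 1ℚ :+ M))) refl (ι m) ⟩
  ½ * (1ℚ + ι m) * (1ℚ + (1ℚ + ι m))     ≡⟨ cong (λ M → ½ * M * (1ℚ + M)) (ι-+ 1 m) ⟨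
  ½ * ι (suc m) * (1ℚ + ι (suc m))       ∎

ι-totalSumel-suc : ∀ l m →
  ι (totalSumel (suc l) m)
  ≡ (½ * ι m * (1ℚ + ι m) * (ι (nRGS l (suc m)) - ι (nRGS l m)) + ι m * ι (totalSumel l m))
    + ((1ℚ + ι m) * (ι (nRGS l (suc (suc m))) - ι (nRGS l (suc m))) + ι (totalSumel l (suc m)))
ι-totalSumel-suc l m = begin
  ι ((triangle m *ℕ R +ℕ m *ℕ U) +ℕ (suc m *ℕ R′ +ℕ U′))
    ≡⟨ ι-+ (triangle m *ℕ R +ℕ m *ℕ U) (suc m *ℕ R′ +ℕ U′) ⟩
  ι (triangle m *ℕ R +ℕ m *ℕ U) + ι (suc m *ℕ R′ +ℕ U′)
    ≡⟨ cong₂ _+_ (trans (ι-+ (triangle m *ℕ R) (m *ℕ U)) (cong₂ _+_ (ι-* (triangle m) R) (ι-* m U)))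
                 (trans (ι-+ (suc m *ℕ R′) U′) (cong (_+ ι U′) (ι-* (suc m) R′))) ⟩
  (ι (triangle m) * ι R + ι m * ι U) + (ι (suc m) * ι R′ + ι U′)
    ≡⟨ cong₂ (λ x y → (x + ι m * ι U) + (y + ι U′))
             (cong₂ _*_ (ι-triangle m) (ι-totalRecords l m))
             (cong₂ _*_ (ι-+ 1 m) (ι-totalRecords l (suc m))) ⟩
  (½ * ι m * (1ℚ + ι m) * (ι (nRGS l (suc m)) - ι (nRGS l m)) + ι m * ι U)
    + ((1ℚ + ι m) * (ι (nRGS l (suc (suc m))) - ι (nRGS l (suc m))) + ι U′) ∎
  where
  R = totalRecords l m
  R′ = totalRecords l (suc m)
  U = totalSumel l m
  U′ = totalSumel l (suc m)

sumelClosedForm : (l m s₀ s₁ s₂ s₃ : ℚ) → ℚ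
sumelClosedForm l m s₀ s₁ s₂ s₃ =
  (+ 1 / 3) * s₃ + (m + + 3 / 4) * s₂ + (½ * m * (m - 1ℚ) - 1ℚ - ½ * l) * s₁
    - (+ 1 / 12 + ½ * (m + 1ℚ) * (m + l)) * s₀

sumelClosedFormᴾ : ∀ {k} (l m s₀ s₁ s₂ s₃ : Polynomial k) → Polynomial k
sumelClosedFormᴾ l m s₀ s₁ s₂ s₃ =
  con (+ 1 / 3) :* s₃ :+ (m :+ con (+ 3 / 4)) :* s₂ :+ (con ½ :* m :* (m :- con 1ℚ) :- con 1ℚ :- con ½ :* l) :* s₁
    :- (con (+ 1 / 12) :+ con ½ :* (m :+ con 1ℚ) :* (m :+ l)) :* s₀

sumelClosedForm-cong : ∀ {l l′ m s₀ s₀′ s₁ s₁′ s₂ s₂′ s₃ s₃′} →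
  l ≡ l′ → s₀ ≡ s₀′ → s₁ ≡ s₁′ → s₂ ≡ s₂′ → s₃ ≡ s₃′ →
  sumelClosedForm l m s₀ s₁ s₂ s₃ ≡ sumelClosedForm l′ m s₀′ s₁′ s₂′ s₃′
sumelClosedForm-cong refl refl refl refl refl = refl

sumelClosedForm-step : ∀ l m s₀ s₁ s₂ s₃ s₄ →
  (½ * m * (1ℚ + m) * (s₁ - s₀) + m * sumelClosedForm l m s₀ s₁ s₂ s₃)
    + ((1ℚ + m) * (s₂ - s₁) + sumelClosedForm l (1ℚ + m) s₁ s₂ s₃ s₄)
  ≡ sumelClosedForm (ι 1 + l) m ((ι 0 + m) * s₀ + s₁) ((ι 1 + m) * s₁ + s₂)
                                ((ι 2 + m) * s₂ + s₃) ((ι 3 + m) * s₃ + s₄)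
sumelClosedForm-step = solve 7 (λ l m s₀ s₁ s₂ s₃ s₄ →
  (con ½ :* m :* (con 1ℚ :+ m) :* (s₁ :- s₀) :+ m :* sumelClosedFormᴾ l m s₀ s₁ s₂ s₃)
    :+ ((con 1ℚ :+ m) :* (s₂ :- s₁) :+ sumelClosedFormᴾ l (con 1ℚ :+ m) s₁ s₂ s₃ s₄)
  := sumelClosedFormᴾ (con (ι 1) :+ l) m ((con (ι 0) :+ m) :* s₀ :+ s₁) ((con (ι 1) :+ m) :* s₁ :+ s₂)
                      ((con (ι 2) :+ m) :* s₂ :+ s₃) ((con (ι 3) :+ m) :* s₃ :+ s₄)) refl

totalSumel-closed : ∀ l m → ι (totalSumel l m)
  ≡ sumelClosedForm (ι l) (ι m) (ι (nRGS l m)) (ι (nRGS l (1 +ℕ m))) (ι (nRGS l (2 +ℕ m))) (ι (nRGS l (3 +ℕ m)))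
totalSumel-closed zero    m =
  solve 1 (λ m → con 0ℚ := sumelClosedFormᴾ (con 0ℚ) m (con 1ℚ) (con 1ℚ) (con 1ℚ) (con 1ℚ)) refl (ι m)
totalSumel-closed (suc l) m = begin
  ι (totalSumel (suc l) m)
    ≡⟨ ι-totalSumel-suc l m ⟩
  (½ * M * (1ℚ + M) * (s 1 - s 0) + M * ι (totalSumel l m)) + ((1ℚ + M) * (s 2 - s 1) + ι (totalSumel l (suc m)))
    ≡⟨ cong₂ (λ u u′ → (½ * M * (1ℚ + M) * (s 1 - s 0) + M * u) + ((1ℚ + M) * (s 2 - s 1) + u′))
             (totalSumel-closed l m)
             (trans (totalSumel-closed l (suc m))
                    (cong (λ M′ → sumelClosedForm L M′ (s 1) (s 2) (s 3) (s 4)) (ι-+ 1 m))) ⟩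
  (½ * M * (1ℚ + M) * (s 1 - s 0) + M * sumelClosedForm L M (s 0) (s 1) (s 2) (s 3))
    + ((1ℚ + M) * (s 2 - s 1) + sumelClosedForm L (1ℚ + M) (s 1) (s 2) (s 3) (s 4))
    ≡⟨ sumelClosedForm-step L M (s 0) (s 1) (s 2) (s 3) (s 4) ⟩
  sumelClosedForm (ι 1 + L) M ((ι 0 + M) * s 0 + s 1) ((ι 1 + M) * s 1 + s 2)
                              ((ι 2 + M) * s 2 + s 3) ((ι 3 + M) * s 3 + s 4)
    ≡⟨ sumelClosedForm-cong {m = M} (ι-+ 1 l) (s′≡ 0) (s′≡ 1) (s′≡ 2) (s′≡ 3) ⟨
  sumelClosedForm (ι (suc l)) M (s′ 0) (s′ 1) (s′ 2) (s′ 3) ∎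
  where
  L = ι l
  M = ι m
  s s′ : ℕ → ℚ
  s j = ι (nRGS l (j +ℕ m))
  s′ j = ι (nRGS (suc l) (j +ℕ m))
  s′≡ : ∀ j → s′ j ≡ (ι j + M) * s j + s (suc j)
  s′≡ j = trans (ι-nRGS-suc l (j +ℕ m)) (cong (λ x → x * s j + s (suc j)) (ι-+ j m))

sumelClosedForm-at-0 : ∀ l t₀ t₁ t₂ t₃ {b₀ b₁ b₂ b₃} →
  b₀ ≡ t₀ → b₁ ≡ t₁ → b₂ ≡ t₁ + t₂ → b₃ ≡ t₁ + ι 3 * t₂ + t₃ →
  sumelClosedForm l 0ℚ t₀ t₁ t₂ t₃
  ≡ (+ 1 / 3) * b₃ - (+ 1 / 4) * b₂ - ((+ 1 / 2) * l + + 13 / 12) * b₁ - (+ 1 / 12 + (+ 1 / 2) * l) * b₀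
sumelClosedForm-at-0 l t₀ t₁ t₂ t₃ refl refl refl refl = solve 5 (λ l t₀ t₁ t₂ t₃ →
  sumelClosedFormᴾ l (con 0ℚ) t₀ t₁ t₂ t₃
  := con (+ 1 / 3) :* (t₁ :+ con (ι 3) :* t₂ :+ t₃) :- con (+ 1 / 4) :* (t₁ :+ t₂)
     :- (con (+ 1 / 2) :* l :+ con (+ 13 / 12)) :* t₁ :- (con (+ 1 / 12) :+ con (+ 1 / 2) :* l) :* t₀)
  refl l t₀ t₁ t₂ t₃

theorem4 : (n : ℕ) →
    + sum (map sumelements (P n)) / 1
      ≡ (+ 1 / 3) * (+ Bell (n +ℕ 3) / 1) - (+ 1 / 4) * (+ Bell (n +ℕ 2) / 1)
        - ((+ 1 / 2) * (+ n / 1) + + 13 / 12) * (+ Bell (n +ℕ 1) / 1)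
        - (+ 1 / 12 + (+ 1 / 2) * (+ n / 1)) * (+ Bell n / 1)
theorem4 n = begin
  ι (sum (map sumelements (P n)))          ≡⟨ cong ι (sum-sumelements n) ⟩
  ι (totalSumel n 0)                       ≡⟨ totalSumel-closed n 0 ⟩
  sumelClosedForm (ι n) 0ℚ (t 0) (t 1) (t 2) (t 3)
    ≡⟨ sumelClosedForm-at-0 (ι n) (t 0) (t 1) (t 2) (t 3) B₀ B₁ B₂ B₃ ⟩
  (+ 1 / 3) * ι (Bell (n +ℕ 3)) - (+ 1 / 4) * ι (Bell (n +ℕ 2))
    - ((+ 1 / 2) * ι n + + 13 / 12) * ι (Bell (n +ℕ 1)) - (+ 1 / 12 + (+ 1 / 2) * ι n) * ι (Bell n) ∎
  where
  t : ℕ → ℚ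
  t j = ι (nRGS n j)
  B₀ : ι (Bell n) ≡ t 0
  B₀ = cong ι (sym (nRGS-Bell n))
  B₁ : ι (Bell (n +ℕ 1)) ≡ t 1
  B₁ = cong ι (Bell-+ n 1)
  B₂ : ι (Bell (n +ℕ 2)) ≡ t 1 + t 2
  B₂ = trans (cong ι (trans (Bell-+ n 2) (nRGS-2+n n))) (ι-+ (nRGS n 1) (nRGS n 2))
  B₃ : ι (Bell (n +ℕ 3)) ≡ t 1 + ι 3 * t 2 + t 3
  B₃ = begin
    ι (Bell (n +ℕ 3))                          ≡⟨ cong ι (trans (Bell-+ n 3) (nRGS-3+n n)) ⟩
    ι (nRGS n 1 +ℕ 3 *ℕ nRGS n 2 +ℕ nRGS n 3)  ≡⟨ ι-+ (nRGS n 1 +ℕ 3 *ℕ nRGS n 2) (nRGS n 3) ⟩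
    ι (nRGS n 1 +ℕ 3 *ℕ nRGS n 2) + t 3        ≡⟨ cong (_+ t 3) (ι-+ (nRGS n 1) (3 *ℕ nRGS n 2)) ⟩
    t 1 + ι (3 *ℕ nRGS n 2) + t 3              ≡⟨ cong (λ x → t 1 + x + t 3) (ι-* 3 (nRGS n 2)) ⟩
    t 1 + ι 3 * t 2 + t 3                      ∎
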